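{- Let $R$ be a commutative ring with identity and $n\ge2$. Define $\tau^{(n)}:R^{n-1}\to U^{(n)}_R$ by $$\tau^{(n)}(x_0,\dots,x_{n-2})=\text{the length- }n\text{ truncation of } P^{(1)}(x_0)\star P^{(2)}(x_1)\star\cdots\star P^{(n-1)}(x_{n-2}).$$ Then $\tau^{(n)}$ is a group isomorphism from $(R^{n-1},+)$ (componentwise addition) onto $(U^{(n)}_R,\star_n)$.
   Context: For sequences over a commutative ring, the Hurwitz product is $(\boldsymbol{a}\star\boldsymbol{b})_m=\sum_{h=0}^m\binom{m}{h}a_hb_{m-h}$. $U^{(n)}_R$ is the set of $n$-tuples $(1,a_1,\dots,a_{n-1})$ with $a_i\in R$, with the truncated Hurwitz product $\star_n$: $(\boldsymbol{a}\star_n\boldsymbol{b})_m=\sum_{h=0}^m\binom{m}{h}a_hb_{m-h}$ for $0\le m\le n-1$. For $y\in R$ and integer $i\ge1$, $P^{(i)}(y)$ is the sequence given by: $P^{(1)}(y)_m=y^m$ for all $m\ge0$; and for $i\ge2$, $P^{(i)}(y)_0=1$, $P^{(i)}(y)_m=0$ if $i\nmid m$, and $P^{(i)}(y)_{ki}=\frac{(ik)!}{k!\,(i!)^k}\prod_{h=1}^{k}(y-h+1)$ for $k\ge1$ (the coefficients $\frac{(ik)!}{k!(i!)^k}$ are integers). (These are the Hurwitz powers $(\boldsymbol{b}^{(i)})^y$ of $\boldsymbol{b}^{(1)}=(1,1,1,\dots)$ and, for $i\ge2$, of $\boldsymbol{b}^{(i)}$, the sequence with $1$ in positions $0$ and $i$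 and $0$ elsewhere.) -}

module Defs where

open import Level using (Level)
open import Algebra.Bundles using (CommutativeRing)
open import Data.Nat as ℕ using (ℕ; zero; suc; _∸_; _%_; _/_; _≟_; _<?_; NonZero; _!)
open import Data.Nat.Properties using (m*n≢0; m^n≢0; _!≢0)
open import Data.Nat.Combinatorics using (_C_)
open import Relation.Binary.PropositionalEquality using (_≡_)
open import Data.Fin using (Fin; toℕ; fromℕ; fromℕ<; inject₁)
open import Data.Product using (Σ; _×_; _,_)
open import Relation.Nullary using (yes; no)

-- Multinomial coefficient (ik)! / (k! (i!)^k)  (an integer; i ≥ 1 assumed where used)
multiCoef : (i k : ℕ) → ℕ
multiCoef i k =
  ((i ℕ.* k) !  / (k ! ℕ.* ((i !) ℕ.^ k)))
    {{m*n≢0 (k !) ((i !) ℕ.^ k) {{k !≢0}} {{m^n≢0 (i !) k {{i !≢0}}}}}}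

module Hurwitz {c ℓ : Level} (R : CommutativeRing c ℓ) where
  open CommutativeRing R

  ι : ℕ → Carrier
  ι zero    = 0#
  ι (suc k) = 1# + ι k

  pow : Carrier → ℕ → Carrier
  pow x zero    = 1#
  pow x (suc m) = pow x m * x

  fall : Carrier → ℕ → Carrier
  fall y zero    = 1#
  fall y (suc k) = fall y k * (y - ι k)

  sumTo : ℕ → (ℕ → Carrier) → Carrier
  sumTo zero    f = f 0
  sumTo (suc m) f = sumTo m f + f (suc m)

  Seq : Set c
  Seq = ℕ → Carrier

  _⋆_ : Seq → Seq → Seq
  (a ⋆ b) m = sumTo m (λ h → ι (m C h) * (a h * b (m ∸ h)))

  one : Seq
  one zero    = 1#
  one (suc _) = 0#

  -- P^{(i)}(y) (the index i = 0 is never used; defined arbitrarily as one)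
  P : ℕ → Carrier → Seq
  P zero          y = one
  P (suc zero)    y m = pow y m
  P (suc (suc j)) y m with m % suc (suc j) ≟ 0
  ... | yes _ = ι (multiCoef (suc (suc j)) (m / suc (suc j))) * fall y (m / suc (suc j))
  ... | no  _ = 0#

  prodP : (m : ℕ) → (Fin m → Carrier) → Seq
  prodP zero    x = one
  prodP (suc m) x = prodP m (λ j → x (inject₁ j)) ⋆ P (suc m) (x (fromℕ m))

  ext : {n : ℕ} → (Fin n → Carrier) → Seq
  ext {n} a m with m <? n
  ... | yes m<n = a (fromℕ< m<n)
  ... | no  _   = 0#

  trunc : (n : ℕ) → Seq → Fin n → Carrier
  trunc n a j = a (toℕ j)

  _⋆[_]_ : {n : ℕ} → (Fin n → Carrier) → (n : ℕ) → (Fin n → Carrier) → Fin n → Carrier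
  (a ⋆[ n ] b) = trunc n (ext a ⋆ ext b)

  -- U^{(n)}_R: n-tuples with first entry 1 (stated via entry at index 0)
  InU : (n : ℕ) → (Fin n → Carrier) → Set ℓ
  InU n a = (j : Fin n) → toℕ j ≡ 0 → a j ≈ 1#

  _≋_ : {m : ℕ} → (Fin m → Carrier) → (Fin m → Carrier) → Set ℓ
  a ≋ b = ∀ j → a j ≈ b j

  _⊕_ : {m : ℕ} → (Fin m → Carrier) → (Fin m → Carrier) → Fin m → Carrier
  (a ⊕ b) j = a j + b j

  τ : (n : ℕ) → (Fin (n ∸ 1) → Carrier) → Fin n → Carrier
  τ n x = trunc n (prodP (n ∸ 1) x)

{-# OPTIONS --safe #-}
module Submission where

-- Each P^(i)(y) is additive in y for the Hurwitz product: for i = 1 this is the binomial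
-- theorem, for i ≥ 2 it is the Chu–Vandermonde identity for falling factorials combined with
-- C(ik, ij) M(j) M(k-j) = M(k) C(k, j) for the coefficients M(k) = (ik)! / (k! (i!)^k).
-- As ⋆ is associative and commutative, τ is a homomorphism. Moreover P^(i)(y) is 1 at
-- position 0, vanishes at positions 1, ..., i-1 and is y at position i, so τ is triangular:
-- entry t+1 of τ(x) is x_t plus a function of x_0, ..., x_(t-1). Solving for x_0, x_1, ...
-- in turn gives injectivity and surjectivity.

open import Defs
open import Level using (Level)
open import Algebra.Bundles using (CommutativeRing)
open import Data.Nat using (ℕ; suc; s≤s; _≤_; _∸_)
open import Data.Fin using (Fin)
open import Data.Product using (Σ; _×_; _,_)

module BlockCount where
  open import Data.Nat
  open import Data.Nat.Properties
  open import Data.Nat.DivMod using (/-congˡ; m*n/n≡m; m/n*n≡m)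
  open import Data.Nat.Combinatorics using (_C_; nCk≡n!/k![n-k]!; k![n∸k]!∣n!; nCk≡nC[n∸k]; nCn≡1)
  open import Relation.Binary.PropositionalEquality
  open import Data.Nat.Solver using (module +-*-Solver)
  open +-*-Solver using (solve; _:*_; _:+_; _:=_; con)
  open ≡-Reasoning

  nCk*[k!*[n∸k]!]≡n! : ∀ {n k} → k ≤ n → (n C k) * (k ! * (n ∸ k) !) ≡ n !
  nCk*[k!*[n∸k]!]≡n! {n} {k} k≤n =
    trans (cong (_* (k ! * (n ∸ k) !)) (nCk≡n!/k![n-k]! k≤n))
          (m/n*n≡m {{k !* (n ∸ k) !≢0}} (k![n∸k]!∣n! k≤n))

  nC0≡1 : ∀ n → n C 0 ≡ 1
  nC0≡1 n = trans (nCk≡nC[n∸k] {n = n} z≤n) (nCn≡1 n)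

  mC[k+j]*[k+j]Ck≡mCk*[m∸k]Cj : ∀ m k j → k ≤ m → j ≤ m ∸ k →
    (m C (k + j)) * ((k + j) C k) ≡ (m C k) * ((m ∸ k) C j)
  mC[k+j]*[k+j]Ck≡mCk*[m∸k]Cj m k j k≤m j≤m∸k = *-cancelʳ-≡ _ _ D {{D≢0}} (begin
      (m C (k + j)) * ((k + j) C k) * D
    ≡⟨ solve 5 (λ a b x y z → a :* b :* (x :* y :* z) := a :* (b :* (x :* y)) :* z) refl
         (m C (k + j)) ((k + j) C k) (k !) (j !) ((m ∸ (k + j)) !) ⟩
      (m C (k + j)) * (((k + j) C k) * (k ! * j !)) * (m ∸ (k + j)) !
    ≡⟨ cong (λ z → (m C (k + j)) * (((k + j) C k) * (k ! * z !)) * (m ∸ (k + j)) !) (sym (m+n∸m≡n k j)) ⟩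
      (m C (k + j)) * (((k + j) C k) * (k ! * (k + j ∸ k) !)) * (m ∸ (k + j)) !
    ≡⟨ cong (λ z → (m C (k + j)) * z * (m ∸ (k + j)) !) (nCk*[k!*[n∸k]!]≡n! (m≤m+n k j)) ⟩
      (m C (k + j)) * (k + j) ! * (m ∸ (k + j)) !
    ≡⟨ *-assoc (m C (k + j)) _ _ ⟩
      (m C (k + j)) * ((k + j) ! * (m ∸ (k + j)) !)
    ≡⟨ nCk*[k!*[n∸k]!]≡n! k+j≤m ⟩
      m !
    ≡⟨ sym (nCk*[k!*[n∸k]!]≡n! k≤m) ⟩
      (m C k) * (k ! * (m ∸ k) !)
    ≡⟨ cong (λ z → (m C k) * (k ! * z)) (sym (nCk*[k!*[n∸k]!]≡n! j≤m∸k)) ⟩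
      (m C k) * (k ! * (((m ∸ k) C j) * (j ! * (m ∸ k ∸ j) !)))
    ≡⟨ cong (λ z → (m C k) * (k ! * (((m ∸ k) C j) * (j ! * z !)))) (∸-+-assoc m k j) ⟩
      (m C k) * (k ! * (((m ∸ k) C j) * (j ! * (m ∸ (k + j)) !)))
    ≡⟨ solve 5 (λ a b x y z → a :* (x :* (b :* (y :* z))) := a :* b :* (x :* y :* z)) refl
         (m C k) ((m ∸ k) C j) (k !) (j !) ((m ∸ (k + j)) !) ⟩
      (m C k) * ((m ∸ k) C j) * D ∎)
    where
    D = k ! * j ! * (m ∸ (k + j)) !
    D≢0 : NonZero D
    D≢0 = m*n≢0 _ _ {{m*n≢0 _ _ {{k !≢0}} {{j !≢0}}}} {{(m ∸ (k + j)) !≢0}}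
    k+j≤m : k + j ≤ m
    k+j≤m = ≤-trans (+-monoʳ-≤ k j≤m∸k) (≤-reflexive (m+[n∸m]≡n k≤m))

  -- blockCount i k counts the partitions of i k points into k blocks of size i, i.e. it is
  -- multiCoef i k: the other i - 1 members of the block of the last point are chosen among
  -- the remaining i k - 1 points.
  blockCount : ℕ → ℕ → ℕ
  blockCount i zero    = 1
  blockCount i (suc k) = blockCount i k * ((i * k + pred i) C pred i)

  blockCount*[k!*[i!]^k]≡[ik]! : ∀ i k → blockCount (suc i) k * (k ! * (suc i !) ^ k) ≡ (suc i * k) !
  blockCount*[k!*[i!]^k]≡[ik]! i zero    = cong _! (sym (*-zeroʳ i))
  blockCount*[k!*[i!]^k]≡[ik]! i (suc k) = begin
      B * (n C i) * (suc k * k ! * (suc i * i ! * (suc i !) ^ k))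
    ≡⟨ solve 7 (λ b c k kf if p i → b :* c :* ((con 1 :+ k) :* kf :* ((con 1 :+ i) :* if :* p))
          := ((con 1 :+ k) :* (con 1 :+ i)) :* (c :* (if :* (b :* (kf :* p))))) refl
          B (n C i) k (k !) (i !) ((suc i !) ^ k) i ⟩
      suc k * suc i * ((n C i) * (i ! * (B * (k ! * (suc i !) ^ k))))
    ≡⟨ cong (λ z → suc k * suc i * ((n C i) * (i ! * z))) (blockCount*[k!*[i!]^k]≡[ik]! i k) ⟩
      suc k * suc i * ((n C i) * (i ! * (suc i * k) !))
    ≡⟨ cong (λ z → suc k * suc i * ((n C i) * (i ! * z !))) (sym (m+n∸n≡m (suc i * k) i)) ⟩
      suc k * suc i * ((n C i) * (i ! * (n ∸ i) !))
    ≡⟨ cong (suc k * suc i *_) (nCk*[k!*[n∸k]!]≡n! (m≤n+m i (suc i * k))) ⟩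
      suc k * suc i * n !
    ≡⟨ cong (_* n !) (solve 2 (λ k i → (con 1 :+ k) :* (con 1 :+ i) := con 1 :+ ((con 1 :+ i) :* k :+ i)) refl k i) ⟩
      suc n !
    ≡⟨ cong _! (solve 2 (λ k i → con 1 :+ ((con 1 :+ i) :* k :+ i) := (con 1 :+ i) :* (con 1 :+ k)) refl k i) ⟩
      (suc i * suc k) ! ∎
    where
    B = blockCount (suc i) k
    n = suc i * k + i

  private
    k!*[i!]^k≢0 : ∀ i k → NonZero (k ! * (suc i !) ^ k)
    k!*[i!]^k≢0 i k = m*n≢0 _ _ {{k !≢0}} {{m^n≢0 (suc i !) k {{suc i !≢0}}}}

  multiCoef≡blockCount : ∀ i k → multiCoef (suc i) k ≡ blockCount (suc i) k
  multiCoef≡blockCount i k =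
    trans (/-congˡ {{k!*[i!]^k≢0 i k}} (sym (blockCount*[k!*[i!]^k]≡[ik]! i k)))
          (m*n/n≡m (blockCount (suc i) k) _ {{k!*[i!]^k≢0 i k}})

  [ik]C[ij]*B[j]*B[k∸j]≡B[k]*kCj : ∀ i j k → j ≤ k →
    ((suc i * k) C (suc i * j)) * blockCount (suc i) j * blockCount (suc i) (k ∸ j)
      ≡ blockCount (suc i) k * (k C j)
  [ik]C[ij]*B[j]*B[k∸j]≡B[k]*kCj i j k j≤k = *-cancelʳ-≡ _ _ D {{D≢0}} (begin
      c * Bj * Bk∸j * (j ! * (k ∸ j) ! * F ^ k)
    ≡⟨ cong (λ z → c * Bj * Bk∸j * (j ! * (k ∸ j) ! * F ^ z)) (sym (m+[n∸m]≡n j≤k)) ⟩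
      c * Bj * Bk∸j * (j ! * (k ∸ j) ! * F ^ (j + (k ∸ j)))
    ≡⟨ cong (λ z → c * Bj * Bk∸j * (j ! * (k ∸ j) ! * z)) (^-distribˡ-+-* F j (k ∸ j)) ⟩
      c * Bj * Bk∸j * (j ! * (k ∸ j) ! * (F ^ j * F ^ (k ∸ j)))
    ≡⟨ solve 7 (λ c a b jf kjf p q → c :* a :* b :* (jf :* kjf :* (p :* q))
          := c :* ((a :* (jf :* p)) :* (b :* (kjf :* q)))) refl c Bj Bk∸j (j !) ((k ∸ j) !) (F ^ j) (F ^ (k ∸ j)) ⟩
      c * ((Bj * (j ! * F ^ j)) * (Bk∸j * ((k ∸ j) ! * F ^ (k ∸ j))))
    ≡⟨ cong₂ (λ a b → c * (a * b)) (blockCount*[k!*[i!]^k]≡[ik]! i j) (blockCount*[k!*[i!]^k]≡[ik]! i (k ∸ j)) ⟩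
      c * ((suc i * j) ! * (suc i * (k ∸ j)) !)
    ≡⟨ cong (λ z → c * ((suc i * j) ! * z !)) (*-distribˡ-∸ (suc i) k j) ⟩
      c * ((suc i * j) ! * (suc i * k ∸ suc i * j) !)
    ≡⟨ nCk*[k!*[n∸k]!]≡n! (*-monoʳ-≤ (suc i) j≤k) ⟩
      (suc i * k) !
    ≡⟨ sym (blockCount*[k!*[i!]^k]≡[ik]! i k) ⟩
      Bk * (k ! * F ^ k)
    ≡⟨ cong (λ z → Bk * (z * F ^ k)) (sym (nCk*[k!*[n∸k]!]≡n! j≤k)) ⟩
      Bk * ((k C j) * (j ! * (k ∸ j) !) * F ^ k)
    ≡⟨ solve 5 (λ b c x y p → b :* (c :* (x :* y) :* p) := b :* c :* (x :* y :* p)) refl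
         Bk (k C j) (j !) ((k ∸ j) !) (F ^ k) ⟩
      Bk * (k C j) * (j ! * (k ∸ j) ! * F ^ k) ∎)
    where
    F = suc i !
    c = (suc i * k) C (suc i * j)
    Bj = blockCount (suc i) j
    Bk∸j = blockCount (suc i) (k ∸ j)
    Bk = blockCount (suc i) k
    D = j ! * (k ∸ j) ! * F ^ k
    D≢0 : NonZero D
    D≢0 = m*n≢0 _ _ {{m*n≢0 _ _ {{j !≢0}} {{(k ∸ j) !≢0}}}} {{m^n≢0 F k {{suc i !≢0}}}}

module HurwitzAlgebra {c ℓ : Level} (R : CommutativeRing c ℓ) where
  open CommutativeRing R hiding (zero)
  open Hurwitz R
  import Data.Nat as ℕ
  import Data.Nat.Properties as ℕ
  open import Data.Nat using (zero; suc; 2+; z≤n; s≤s; _<_; _%_; _/_)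
  open import Data.Nat.DivMod using (m*n/n≡m; m*n%n≡0)
  open import Data.Nat.Divisibility
    using (_∣_; _∣?_; divides; m%n≡0⇒n∣m; ∣⇒≤; ∣m+n∣m⇒∣n; n∣m*n; ∣m∸n∣n⇒∣m)
  open import Relation.Nullary using (¬_; yes; no; contradiction)
  open import Data.Fin using (zero; suc; toℕ; fromℕ; fromℕ<; inject₁; lower₁)
  open import Data.Fin.Properties using (toℕ-fromℕ; toℕ-fromℕ<; fromℕ<-toℕ; toℕ<n; toℕ-injective; inject₁-lower₁)
  open import Data.Vec.Functional using (init; last)
  open import Data.Product using (proj₁; proj₂)
  open import Function using (_∘_)
  open import Data.Nat.Combinatorics using (_C_; nCk≡nC[n∸k]; nCn≡1; k>n⇒nCk≡0; nCk+nC[k+1]≡[n+1]C[k+1])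
  open import Data.Maybe using (nothing)
  open import Data.Sum using (inj₁; inj₂)
  open import Relation.Binary.PropositionalEquality as ≡ using (_≡_)
  open import Algebra.Properties.Ring ring using (+-cancelˡ; -0#≈0#; -‿+-comm; xyx⁻¹≈y)
  open import Algebra.Properties.Semiring.Mult semiring using (×-homo-+; ×1-homo-*)
    renaming (_×_ to _·_)
  open import Algebra.Solver.Ring.NaturalCoefficients commutativeSemiring (λ _ _ → nothing)
    using (solve; _:+_; _:*_; _:=_)
  open import Relation.Binary.Reasoning.Setoid setoid
  open import Relation.Binary.Structures using (IsEquivalence)
  open import Algebra.Bundles using (CommutativeMonoid)
  open BlockCount

  ι≡·1 : ∀ k → ι k ≡ k · 1#
  ι≡·1 zero    = ≡.refl
  ι≡·1 (suc k) = ≡.cong (1# +_) (ι≡·1 k)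

  ι-homo-+ : ∀ a b → ι (a ℕ.+ b) ≈ ι a + ι b
  ι-homo-+ a b rewrite ι≡·1 (a ℕ.+ b) | ι≡·1 a | ι≡·1 b = ×-homo-+ 1# a b

  ι-homo-* : ∀ a b → ι (a ℕ.* b) ≈ ι a * ι b
  ι-homo-* a b rewrite ι≡·1 (a ℕ.* b) | ι≡·1 a | ι≡·1 b = ×1-homo-* a b

  ι-cong : ∀ {a b} → a ≡ b → ι a ≈ ι b
  ι-cong ≡.refl = refl

  ι1≈1 : ι 1 ≈ 1#
  ι1≈1 = +-identityʳ 1#

  ιnC0≈1 : ∀ n → ι (n C 0) ≈ 1#
  ιnC0≈1 n = trans (ι-cong (nC0≡1 n)) ι1≈1

  ιnCn≈1 : ∀ n → ι (n C n) ≈ 1#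
  ιnCn≈1 n = trans (ι-cong (nCn≡1 n)) ι1≈1


  sumTo-cong : ∀ m {f g : ℕ → Carrier} → (∀ h → h ℕ.≤ m → f h ≈ g h) → sumTo m f ≈ sumTo m g
  sumTo-cong zero    f≈g = f≈g 0 z≤n
  sumTo-cong (suc m) f≈g = +-cong (sumTo-cong m (λ h h≤m → f≈g h (ℕ.m≤n⇒m≤1+n h≤m))) (f≈g (suc m) ℕ.≤-refl)

  sumTo-+ : ∀ m (f g : ℕ → Carrier) → sumTo m (λ h → f h + g h) ≈ sumTo m f + sumTo m g
  sumTo-+ zero    f g = refl
  sumTo-+ (suc m) f g = trans (+-congʳ (sumTo-+ m f g))
    (solve 4 (λ a b c d → (a :+ b) :+ (c :+ d) := (a :+ c) :+ (b :+ d)) refl _ _ _ _)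

  *-distribˡ-sumTo : ∀ m (f : ℕ → Carrier) a → a * sumTo m f ≈ sumTo m (λ h → a * f h)
  *-distribˡ-sumTo zero    f a = refl
  *-distribˡ-sumTo (suc m) f a = trans (distribˡ _ _ _) (+-congʳ (*-distribˡ-sumTo m f a))

  *-distribʳ-sumTo : ∀ m (f : ℕ → Carrier) a → sumTo m f * a ≈ sumTo m (λ h → f h * a)
  *-distribʳ-sumTo zero    f a = refl
  *-distribʳ-sumTo (suc m) f a = trans (distribʳ _ _ _) (+-congʳ (*-distribʳ-sumTo m f a))

  sumTo-zero : ∀ m (f : ℕ → Carrier) → (∀ h → h ℕ.≤ m → f h ≈ 0#) → sumTo m f ≈ 0#
  sumTo-zero zero    f f≈0 = f≈0 0 z≤n
  sumTo-zero (suc m) f f≈0 =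
    trans (+-cong (sumTo-zero m f (λ h h≤m → f≈0 h (ℕ.m≤n⇒m≤1+n h≤m))) (f≈0 (suc m) ℕ.≤-refl)) (+-identityˡ 0#)

  sumTo-suc : ∀ m (f : ℕ → Carrier) → sumTo (suc m) f ≈ f 0 + sumTo m (λ h → f (suc h))
  sumTo-suc zero    f = refl
  sumTo-suc (suc m) f = trans (+-congʳ (sumTo-suc m f)) (+-assoc _ _ _)

  sumTo-last : ∀ m (f : ℕ → Carrier) → (∀ h → h < m → f h ≈ 0#) → sumTo m f ≈ f m
  sumTo-last zero    f f≈0 = refl
  sumTo-last (suc m) f f≈0 = trans (+-congʳ (sumTo-zero m f (λ h h≤m → f≈0 h (s≤s h≤m)))) (+-identityˡ _)

  sumTo-first : ∀ m (f : ℕ → Carrier) → (∀ h → h < m → f (suc h) ≈ 0#) → sumTo m f ≈ f 0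
  sumTo-first zero    f f≈0 = refl
  sumTo-first (suc m) f f≈0 = trans (sumTo-suc m f)
    (trans (+-congˡ (sumTo-zero m _ (λ h h≤m → f≈0 h (s≤s h≤m)))) (+-identityʳ _))

  sumTo-reverse : ∀ m (f : ℕ → Carrier) → sumTo m f ≈ sumTo m (λ h → f (m ∸ h))
  sumTo-reverse zero    f = refl
  sumTo-reverse (suc m) f = begin
    sumTo m f + f (suc m)                        ≈⟨ +-congʳ (sumTo-reverse m f) ⟩
    sumTo m (λ h → f (m ∸ h)) + f (suc m)        ≈⟨ +-comm _ _ ⟩
    f (suc m) + sumTo m (λ h → f (m ∸ h))        ≈⟨ sumTo-suc m (λ h → f (suc m ∸ h)) ⟨
    sumTo (suc m) (λ h → f (suc m ∸ h))          ∎

  sumTo-swap : ∀ m k (F : ℕ → ℕ → Carrier) →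
    sumTo m (λ i → sumTo k (λ j → F i j)) ≈ sumTo k (λ j → sumTo m (λ i → F i j))
  sumTo-swap zero    k F = refl
  sumTo-swap (suc m) k F = trans (+-congʳ (sumTo-swap m k F)) (sym (sumTo-+ k _ _))

  sumTo-truncate : ∀ h m (f : ℕ → Carrier) → h ℕ.≤ m → (∀ t → h < t → t ℕ.≤ m → f t ≈ 0#) →
    sumTo m f ≈ sumTo h f
  sumTo-truncate h zero    f z≤n f≈0 = refl
  sumTo-truncate h (suc m) f h≤1+m f≈0 with ℕ.m≤n⇒m<n∨m≡n h≤1+m
  ... | inj₂ ≡.refl      = refl
  ... | inj₁ (s≤s h≤m) =
    trans (+-cong (sumTo-truncate h m f h≤m (λ t h<t t≤m → f≈0 t h<t (ℕ.m≤n⇒m≤1+n t≤m)))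
                  (f≈0 (suc m) (s≤s h≤m) ℕ.≤-refl))
          (+-identityʳ _)

  sumTo-drop : ∀ k m (f : ℕ → Carrier) → k ℕ.≤ m → (∀ h → h < k → f h ≈ 0#) →
    sumTo m f ≈ sumTo (m ∸ k) (λ j → f (k ℕ.+ j))
  sumTo-drop zero    m       f _         f≈0 = refl
  sumTo-drop (suc k) (suc m) f (s≤s k≤m) f≈0 = begin
    sumTo (suc m) f                    ≈⟨ sumTo-suc m f ⟩
    f 0 + sumTo m (λ h → f (suc h))    ≈⟨ +-congʳ (f≈0 0 (s≤s z≤n)) ⟩
    0# + sumTo m (λ h → f (suc h))     ≈⟨ +-identityˡ _ ⟩
    sumTo m (λ h → f (suc h))          ≈⟨ sumTo-drop k m (λ h → f (suc h)) k≤m (λ h h<k → f≈0 (suc h) (s≤s h<k)) ⟩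
    sumTo (m ∸ k) (λ j → f (suc (k ℕ.+ j))) ∎

  sumTo-split : ∀ a b (f : ℕ → Carrier) → sumTo (suc b ℕ.+ a) f ≈ sumTo a f + sumTo b (λ t → f (suc t ℕ.+ a))
  sumTo-split a zero    f = refl
  sumTo-split a (suc b) f = trans (+-congʳ (sumTo-split a b f)) (+-assoc _ _ _)

  infix 4 _≈ₛ_
  _≈ₛ_ : Seq → Seq → Set ℓ
  a ≈ₛ b = ∀ m → a m ≈ b m

  ≈ₛ-isEquivalence : IsEquivalence _≈ₛ_
  ≈ₛ-isEquivalence = record
    { refl  = λ _ → refl
    ; sym   = λ a≈b m → sym (a≈b m)
    ; trans = λ a≈b b≈c m → trans (a≈b m) (b≈c m)
    }

  ⋆-cong-≤ : ∀ {a a′ b b′ : Seq} m → (∀ h → h ℕ.≤ m → a h ≈ a′ h) → (∀ h → h ℕ.≤ m → b h ≈ b′ h) →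
    (a ⋆ b) m ≈ (a′ ⋆ b′) m
  ⋆-cong-≤ m a≈a′ b≈b′ =
    sumTo-cong m (λ h h≤m → *-congˡ (*-cong (a≈a′ h h≤m) (b≈b′ (m ∸ h) (ℕ.m∸n≤m m h))))

  ⋆-cong : ∀ {a a′ b b′ : Seq} → a ≈ₛ a′ → b ≈ₛ b′ → a ⋆ b ≈ₛ a′ ⋆ b′
  ⋆-cong a≈a′ b≈b′ m = ⋆-cong-≤ m (λ h _ → a≈a′ h) (λ h _ → b≈b′ h)

  ⋆-comm : ∀ a b → a ⋆ b ≈ₛ b ⋆ a
  ⋆-comm a b m = trans (sumTo-reverse m _) (sumTo-cong m λ h h≤m →
    trans (*-cong (ι-cong (≡.sym (nCk≡nC[n∸k] h≤m)))
                  (*-congˡ (reflexive (≡.cong b (ℕ.m∸[m∸n]≡n h≤m)))))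
          (*-congˡ (*-comm _ _)))

  ⋆-identityˡ : ∀ a → one ⋆ a ≈ₛ a
  ⋆-identityˡ a m = trans (sumTo-first m _ (λ h _ → trans (*-congˡ (zeroˡ _)) (zeroʳ _)))
                          (trans (*-cong (ιnC0≈1 m) (*-identityˡ _)) (*-identityˡ _))

  -- Both sides are the sum of m! / (k! j! (m-k-j)!) a_k b_j c_(m-k-j) over k + j ≤ m.
  ⋆-assoc : ∀ a b c → (a ⋆ b) ⋆ c ≈ₛ a ⋆ (b ⋆ c)
  ⋆-assoc a b c m = begin
      sumTo m (λ h → ι (m C h) * (sumTo h (λ k → ι (h C k) * (a k * b (h ∸ k))) * c (m ∸ h)))
    ≈⟨ sumTo-cong m (λ h h≤m → expand h h≤m) ⟩
      sumTo m (λ h → sumTo m (λ k → T h k))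
    ≈⟨ sumTo-swap m m T ⟩
      sumTo m (λ k → sumTo m (λ h → T h k))
    ≈⟨ sumTo-cong m (λ k k≤m → trans (sumTo-drop k m (λ h → T h k) k≤m (λ h h<k → T-vanishes h<k))
                                      (sumTo-cong (m ∸ k) (λ j j≤ → reindex k j k≤m j≤))) ⟩
      sumTo m (λ k → sumTo (m ∸ k) (λ j → ι (m C k) * (a k * (ι ((m ∸ k) C j) * (b j * c (m ∸ k ∸ j))))))
    ≈⟨ sumTo-cong m (λ k _ → sym (trans (*-congˡ (*-distribˡ-sumTo (m ∸ k) _ (a k))) (*-distribˡ-sumTo (m ∸ k) _ _))) ⟩
      sumTo m (λ k → ι (m C k) * (a k * sumTo (m ∸ k) (λ j → ι ((m ∸ k) C j) * (b j * c (m ∸ k ∸ j))))) ∎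
    where
    T : ℕ → ℕ → Carrier
    T h k = ι (m C h) * ((ι (h C k) * (a k * b (h ∸ k))) * c (m ∸ h))

    T-vanishes : ∀ {h k} → h < k → T h k ≈ 0#
    T-vanishes h<k =
      trans (*-congˡ (trans (*-congʳ (trans (*-congʳ (ι-cong (k>n⇒nCk≡0 h<k))) (zeroˡ _))) (zeroˡ _))) (zeroʳ _)

    expand : ∀ h → h ℕ.≤ m →
      ι (m C h) * (sumTo h (λ k → ι (h C k) * (a k * b (h ∸ k))) * c (m ∸ h)) ≈ sumTo m (λ k → T h k)
    expand h h≤m = trans (*-congˡ (*-distribʳ-sumTo h _ _)) (trans (*-distribˡ-sumTo h _ _)
                     (sym (sumTo-truncate h m (λ k → T h k) h≤m (λ t h<t _ → T-vanishes h<t))))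

    reindex : ∀ k j → k ℕ.≤ m → j ℕ.≤ m ∸ k →
      T (k ℕ.+ j) k ≈ ι (m C k) * (a k * (ι ((m ∸ k) C j) * (b j * c (m ∸ k ∸ j))))
    reindex k j k≤m j≤m∸k = begin
        ι (m C (k ℕ.+ j)) * ((ι ((k ℕ.+ j) C k) * (a k * b (k ℕ.+ j ∸ k))) * c (m ∸ (k ℕ.+ j)))
      ≈⟨ *-congˡ (*-cong (*-congˡ (*-congˡ (reflexive (≡.cong b (ℕ.m+n∸m≡n k j)))))
                         (reflexive (≡.cong c (≡.sym (ℕ.∸-+-assoc m k j))))) ⟩
        ι (m C (k ℕ.+ j)) * ((ι ((k ℕ.+ j) C k) * (a k * b j)) * c (m ∸ k ∸ j))
      ≈⟨ solve 5 (λ A B x y z → A :* ((B :* (x :* y)) :* z) := (A :* B) :* (x :* (y :* z))) refl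
           (ι (m C (k ℕ.+ j))) (ι ((k ℕ.+ j) C k)) (a k) (b j) (c (m ∸ k ∸ j)) ⟩
        (ι (m C (k ℕ.+ j)) * ι ((k ℕ.+ j) C k)) * (a k * (b j * c (m ∸ k ∸ j)))
      ≈⟨ *-congʳ (trans (sym (ι-homo-* (m C (k ℕ.+ j)) ((k ℕ.+ j) C k)))
                 (trans (ι-cong (mC[k+j]*[k+j]Ck≡mCk*[m∸k]Cj m k j k≤m j≤m∸k)) (ι-homo-* (m C k) ((m ∸ k) C j)))) ⟩
        (ι (m C k) * ι ((m ∸ k) C j)) * (a k * (b j * c (m ∸ k ∸ j)))
      ≈⟨ solve 5 (λ A B x y z → (A :* B) :* (x :* (y :* z)) := A :* (x :* (B :* (y :* z)))) refl
           (ι (m C k)) (ι ((m ∸ k) C j)) (a k) (b j) (c (m ∸ k ∸ j)) ⟩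
        ι (m C k) * (a k * (ι ((m ∸ k) C j) * (b j * c (m ∸ k ∸ j)))) ∎

  open import Algebra.Structures _≈ₛ_ using (IsCommutativeMonoid)
  open import Algebra.Structures.Biased _≈ₛ_ using (isCommutativeMonoidˡ)

  ⋆-isCommutativeMonoid : IsCommutativeMonoid _⋆_ one
  ⋆-isCommutativeMonoid = isCommutativeMonoidˡ (record
    { isSemigroup = record
      { isMagma = record { isEquivalence = ≈ₛ-isEquivalence ; ∙-cong = ⋆-cong }
      ; assoc   = ⋆-assoc
      }
    ; identityˡ = ⋆-identityˡ
    ; comm      = ⋆-comm
    })

  ⋆-commutativeMonoid : CommutativeMonoid c ℓ
  ⋆-commutativeMonoid = record { isCommutativeMonoid = ⋆-isCommutativeMonoid }

  open CommutativeMonoid ⋆-commutativeMonoid public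
    using () renaming (refl to ≈ₛ-refl; sym to ≈ₛ-sym; trans to ≈ₛ-trans)
  open import Algebra.Properties.CommutativeSemigroup (CommutativeMonoid.commutativeSemigroup ⋆-commutativeMonoid)
    using () renaming (interchange to ⋆-interchange)

  shift : Seq → Seq
  shift a m = a (suc m)

  -- Pascal's rule C(k+1, j+1) = C(k, j) + C(k, j+1) splits each coefficient of (a ⋆ b)(k+1).
  ⋆-leibniz : ∀ a b k → (a ⋆ b) (suc k) ≈ (shift a ⋆ b) k + (a ⋆ shift b) k
  ⋆-leibniz a b k = sym (begin
      S₁ + (a ⋆ shift b) k
    ≈⟨ +-congˡ (sumTo-cong k (λ j j≤k → *-congˡ (*-congˡ (reflexive (≡.cong b (≡.sym (ℕ.+-∸-assoc 1 j≤k))))))) ⟩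
      S₁ + sumTo k g
    ≈⟨ +-congˡ (trans (sym (+-identityʳ _)) (+-congˡ (sym g[k+1]≈0))) ⟩
      S₁ + sumTo (suc k) g
    ≈⟨ +-congˡ (sumTo-suc k g) ⟩
      S₁ + (g 0 + S₂)
    ≈⟨ solve 3 (λ x y z → x :+ (y :+ z) := y :+ (x :+ z)) refl S₁ (g 0) S₂ ⟩
      g 0 + (S₁ + S₂)
    ≈⟨ +-cong (*-congʳ (trans (ιnC0≈1 k) (sym (ιnC0≈1 (suc k))))) (sym (sumTo-+ k _ _)) ⟩
      t 0 + sumTo k (λ j → ι (k C j) * (a (suc j) * b (k ∸ j)) + ι (k C suc j) * (a (suc j) * b (k ∸ j)))
    ≈⟨ +-congˡ (sumTo-cong k (λ j _ → trans (sym (distribʳ _ _ _)) (*-congʳ pascal))) ⟩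
      t 0 + sumTo k (λ j → t (suc j))
    ≈⟨ sumTo-suc k t ⟨
      sumTo (suc k) t ∎)
    where
    t g : ℕ → Carrier
    t j = ι (suc k C j) * (a j * b (suc k ∸ j))
    g j = ι (k C j) * (a j * b (suc k ∸ j))
    S₁ = (shift a ⋆ b) k
    S₂ = sumTo k (λ j → ι (k C suc j) * (a (suc j) * b (k ∸ j)))

    g[k+1]≈0 : g (suc k) ≈ 0#
    g[k+1]≈0 = trans (*-congʳ (ι-cong (k>n⇒nCk≡0 (ℕ.n<1+n k)))) (zeroˡ _)

    pascal : ∀ {j} → ι (k C j) + ι (k C suc j) ≈ ι (suc k C suc j)
    pascal {j} = trans (sym (ι-homo-+ (k C j) (k C suc j))) (ι-cong (nCk+nC[k+1]≡[n+1]C[k+1] k j))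

  fallingBy : Carrier → Carrier → Seq
  fallingBy d x zero    = 1#
  fallingBy d x (suc k) = fallingBy d x k * (x - ι k * d)

  x+y-[a+b]*d≈x-a*d+[y-b*d] : ∀ x y a b d → (x + y) - (a + b) * d ≈ (x - a * d) + (y - b * d)
  x+y-[a+b]*d≈x-a*d+[y-b*d] x y a b d = begin
    (x + y) - (a + b) * d              ≈⟨ +-congˡ (-‿cong (distribʳ d a b)) ⟩
    (x + y) - (a * d + b * d)          ≈⟨ +-congˡ (-‿+-comm (a * d) (b * d)) ⟨
    (x + y) + (- (a * d) + - (b * d))  ≈⟨ solve 4 (λ x y p q → (x :+ y) :+ (p :+ q) := (x :+ p) :+ (y :+ q)) refl
                                            x y (- (a * d)) (- (b * d)) ⟩
    (x - a * d) + (y - b * d)          ∎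

  fallingBy-+ : ∀ d x y → fallingBy d (x + y) ≈ₛ fallingBy d x ⋆ fallingBy d y
  fallingBy-+ d x y zero    = sym (trans (*-cong (ιnC0≈1 0) (*-identityˡ 1#)) (*-identityˡ 1#))
  fallingBy-+ d x y (suc k) = begin
      fallingBy d (x + y) k * ((x + y) - ι k * d)
    ≈⟨ *-congʳ (fallingBy-+ d x y k) ⟩
      (X ⋆ Y) k * ((x + y) - ι k * d)
    ≈⟨ *-distribʳ-sumTo k _ _ ⟩
      sumTo k (λ j → ι (k C j) * (X j * Y (k ∸ j)) * ((x + y) - ι k * d))
    ≈⟨ sumTo-cong k (λ j j≤k → split j j≤k) ⟩
      sumTo k (λ j → ι (k C j) * (X (suc j) * Y (k ∸ j)) + ι (k C j) * (X j * Y (suc (k ∸ j))))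
    ≈⟨ sumTo-+ k _ _ ⟩
      (shift X ⋆ Y) k + (X ⋆ shift Y) k
    ≈⟨ ⋆-leibniz X Y k ⟨
      (X ⋆ Y) (suc k) ∎
    where
    X = fallingBy d x
    Y = fallingBy d y
    split : ∀ j → j ℕ.≤ k → ι (k C j) * (X j * Y (k ∸ j)) * ((x + y) - ι k * d)
                          ≈ ι (k C j) * (X (suc j) * Y (k ∸ j)) + ι (k C j) * (X j * Y (suc (k ∸ j)))
    split j j≤k = begin
        ι (k C j) * (X j * Y (k ∸ j)) * ((x + y) - ι k * d)
      ≈⟨ *-congˡ (+-congˡ (-‿cong (*-congʳ (trans (ι-cong (≡.sym (ℕ.m+[n∸m]≡n j≤k))) (ι-homo-+ j (k ∸ j)))))) ⟩
        ι (k C j) * (X j * Y (k ∸ j)) * ((x + y) - (ι j + ι (k ∸ j)) * d)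
      ≈⟨ *-congˡ (x+y-[a+b]*d≈x-a*d+[y-b*d] x y (ι j) (ι (k ∸ j)) d) ⟩
        ι (k C j) * (X j * Y (k ∸ j)) * ((x - ι j * d) + (y - ι (k ∸ j) * d))
      ≈⟨ solve 5 (λ K A B u v → K :* (A :* B) :* (u :+ v) := K :* ((A :* u) :* B) :+ K :* (A :* (B :* v))) refl
           (ι (k C j)) (X j) (Y (k ∸ j)) (x - ι j * d) (y - ι (k ∸ j) * d) ⟩
        ι (k C j) * (X (suc j) * Y (k ∸ j)) + ι (k C j) * (X j * Y (suc (k ∸ j))) ∎

  pow≈fallingBy0 : ∀ x → pow x ≈ₛ fallingBy 0# x
  pow≈fallingBy0 x zero    = refl
  pow≈fallingBy0 x (suc m) =
    *-cong (pow≈fallingBy0 x m) (sym (trans (+-congˡ (trans (-‿cong (zeroʳ _)) -0#≈0#)) (+-identityʳ x)))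

  fall≈fallingBy1 : ∀ x → fall x ≈ₛ fallingBy 1# x
  fall≈fallingBy1 x zero    = refl
  fall≈fallingBy1 x (suc m) = *-cong (fall≈fallingBy1 x m) (+-congˡ (-‿cong (sym (*-identityʳ _))))

  pow-+ : ∀ x y → pow (x + y) ≈ₛ pow x ⋆ pow y
  pow-+ x y = ≈ₛ-trans (pow≈fallingBy0 (x + y)) (≈ₛ-trans (fallingBy-+ 0# x y)
    (⋆-cong (≈ₛ-sym (pow≈fallingBy0 x)) (≈ₛ-sym (pow≈fallingBy0 y))))

  fall-+ : ∀ x y → fall (x + y) ≈ₛ fall x ⋆ fall y
  fall-+ x y = ≈ₛ-trans (fall≈fallingBy1 (x + y)) (≈ₛ-trans (fallingBy-+ 1# x y)
    (⋆-cong (≈ₛ-sym (fall≈fallingBy1 x)) (≈ₛ-sym (fall≈fallingBy1 y))))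

  P-at-multiple : ∀ i k y → P (2+ i) y (k ℕ.* 2+ i) ≈ ι (blockCount (2+ i) k) * fall y k
  P-at-multiple i k y with (k ℕ.* 2+ i) % 2+ i ℕ.≟ 0
  ... | yes _ = trans (reflexive (≡.cong (λ q → ι (multiCoef (2+ i) q) * fall y q) (m*n/n≡m k (2+ i))))
                      (*-congʳ (ι-cong (multiCoef≡blockCount (suc i) k)))
  ... | no k*i%i≢0 = contradiction (m*n%n≡0 k (2+ i)) k*i%i≢0

  P-off-multiple : ∀ i m y → ¬ (2+ i ∣ m) → P (2+ i) y m ≈ 0#
  P-off-multiple i m y i∤m with m % 2+ i ℕ.≟ 0
  ... | yes m%i≡0 = contradiction (m%n≡0⇒n∣m m (2+ i) m%i≡0) i∤m
  ... | no _      = refl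

  pow-cong : ∀ {x y} → x ≈ y → pow x ≈ₛ pow y
  pow-cong x≈y zero    = refl
  pow-cong x≈y (suc m) = *-cong (pow-cong x≈y m) x≈y

  fall-cong : ∀ {x y} → x ≈ y → fall x ≈ₛ fall y
  fall-cong x≈y zero    = refl
  fall-cong x≈y (suc m) = *-cong (fall-cong x≈y m) (+-congʳ x≈y)

  P-cong : ∀ i {x y} → x ≈ y → P (suc i) x ≈ₛ P (suc i) y
  P-cong zero    x≈y m = pow-cong x≈y m
  P-cong (suc i) x≈y m with m % 2+ i ℕ.≟ 0
  ... | yes _ = *-congˡ (fall-cong x≈y (m / 2+ i))
  ... | no _  = refl

  P-at-0 : ∀ i y → P (suc i) y 0 ≈ 1#
  P-at-0 zero    y = refl
  P-at-0 (suc i) y = trans (P-at-multiple i 0 y) (trans (*-identityʳ _) ι1≈1)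

  P-between : ∀ i y t → 0 < t → t < suc i → P (suc i) y t ≈ 0#
  P-between zero    y t 0<t t<1 = contradiction (ℕ.<-≤-trans 0<t (ℕ.s≤s⁻¹ t<1)) ℕ.n≮0
  P-between (suc i) y t 0<t t<i = P-off-multiple i t y (λ i∣t → ℕ.<⇒≱ t<i (∣⇒≤ {{ℕ.>-nonZero 0<t}} i∣t))

  P-at-i : ∀ i y → P (suc i) y (suc i) ≈ y
  P-at-i zero    y = *-identityˡ y
  P-at-i (suc i) y = begin
      P (2+ i) y (2+ i)
    ≈⟨ reflexive (≡.cong (P (2+ i) y) (≡.sym (ℕ.*-identityˡ (2+ i)))) ⟩
      P (2+ i) y (1 ℕ.* 2+ i)
    ≈⟨ P-at-multiple i 1 y ⟩
      ι (1 ℕ.* ((2+ i ℕ.* 0 ℕ.+ suc i) C suc i)) * (1# * (y - 0#))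
    ≈⟨ *-cong (trans (ι-cong (≡.trans (ℕ.*-identityˡ _) (≡.cong (λ n → (n ℕ.+ suc i) C suc i) (ℕ.*-zeroʳ (2+ i)))))
                     (ιnCn≈1 (suc i)))
              (trans (*-identityˡ _) (trans (+-congˡ -0#≈0#) (+-identityʳ y))) ⟩
      1# * y
    ≈⟨ *-identityˡ y ⟩
      y ∎

  sumTo-multiples : ∀ i k (F : ℕ → Carrier) → (∀ h → ¬ (suc i ∣ h) → F h ≈ 0#) →
    sumTo (k ℕ.* suc i) F ≈ sumTo k (λ j → F (j ℕ.* suc i))
  sumTo-multiples i zero    F F≈0 = refl
  sumTo-multiples i (suc k) F F≈0 = begin
      sumTo (suc i ℕ.+ k ℕ.* suc i) F
    ≈⟨ sumTo-split (k ℕ.* suc i) i F ⟩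
      sumTo (k ℕ.* suc i) F + sumTo i (λ t → F (suc t ℕ.+ k ℕ.* suc i))
    ≈⟨ +-cong (sumTo-multiples i k F F≈0) (sumTo-last i _ (λ t t<i → F≈0 _ (i∤ t t<i))) ⟩
      sumTo k (λ j → F (j ℕ.* suc i)) + F (suc k ℕ.* suc i) ∎
    where
    i∤ : ∀ t → t < i → ¬ (suc i ∣ suc t ℕ.+ k ℕ.* suc i)
    i∤ t t<i i∣ = ℕ.<⇒≱ (s≤s t<i)
      (∣⇒≤ (∣m+n∣m⇒∣n (≡.subst (suc i ∣_) (ℕ.+-comm (suc t) (k ℕ.* suc i)) i∣) (n∣m*n k)))

  ιblockCount-split : ∀ i j k → j ℕ.≤ k →
    ι ((k ℕ.* 2+ i) C (j ℕ.* 2+ i)) * ι (blockCount (2+ i) j) * ι (blockCount (2+ i) (k ∸ j))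
      ≈ ι (blockCount (2+ i) k) * ι (k C j)
  ιblockCount-split i j k j≤k = begin
      ι ((k ℕ.* 2+ i) C (j ℕ.* 2+ i)) * ι (blockCount (2+ i) j) * ι (blockCount (2+ i) (k ∸ j))
    ≈⟨ *-congʳ (ι-homo-* ((k ℕ.* 2+ i) C (j ℕ.* 2+ i)) (blockCount (2+ i) j)) ⟨
      ι (((k ℕ.* 2+ i) C (j ℕ.* 2+ i)) ℕ.* blockCount (2+ i) j) * ι (blockCount (2+ i) (k ∸ j))
    ≈⟨ ι-homo-* (((k ℕ.* 2+ i) C (j ℕ.* 2+ i)) ℕ.* blockCount (2+ i) j) (blockCount (2+ i) (k ∸ j)) ⟨
      ι (((k ℕ.* 2+ i) C (j ℕ.* 2+ i)) ℕ.* blockCount (2+ i) j ℕ.* blockCount (2+ i) (k ∸ j))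
    ≈⟨ ι-cong (≡.trans (≡.cong₂ (λ n r → (n C r) ℕ.* blockCount (2+ i) j ℕ.* blockCount (2+ i) (k ∸ j))
                                (ℕ.*-comm k (2+ i)) (ℕ.*-comm j (2+ i)))
                       ([ik]C[ij]*B[j]*B[k∸j]≡B[k]*kCj (suc i) j k j≤k)) ⟩
      ι (blockCount (2+ i) k ℕ.* (k C j))
    ≈⟨ ι-homo-* (blockCount (2+ i) k) (k C j) ⟩
      ι (blockCount (2+ i) k) * ι (k C j) ∎

  -- Only the terms at multiples of i survive, and there the coefficients recombine by
  -- ιblockCount-split into the Chu–Vandermonde expansion of fall (x + y).
  P-+-at-multiple : ∀ i x y q → P (2+ i) (x + y) (q ℕ.* 2+ i) ≈ (P (2+ i) x ⋆ P (2+ i) y) (q ℕ.* 2+ i)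
  P-+-at-multiple i x y q = begin
      P (2+ i) (x + y) (q ℕ.* 2+ i)
    ≈⟨ P-at-multiple i q (x + y) ⟩
      ι (B q) * fall (x + y) q
    ≈⟨ *-congˡ (fall-+ x y q) ⟩
      ι (B q) * sumTo q (λ j → ι (q C j) * (fall x j * fall y (q ∸ j)))
    ≈⟨ *-distribˡ-sumTo q _ _ ⟩
      sumTo q (λ j → ι (B q) * (ι (q C j) * (fall x j * fall y (q ∸ j))))
    ≈⟨ sumTo-cong q (λ j j≤q → sym (term j j≤q)) ⟩
      sumTo q (λ j → F (j ℕ.* 2+ i))
    ≈⟨ sumTo-multiples (suc i) q F F-off-multiple ⟨
      sumTo (q ℕ.* 2+ i) F ∎
    where
    B = blockCount (2+ i)
    F : ℕ → Carrier
    F h = ι ((q ℕ.* 2+ i) C h) * (P (2+ i) x h * P (2+ i) y (q ℕ.* 2+ i ∸ h))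

    F-off-multiple : ∀ h → ¬ (2+ i ∣ h) → F h ≈ 0#
    F-off-multiple h i∤h = trans (*-congˡ (trans (*-congʳ (P-off-multiple i h x i∤h)) (zeroˡ _))) (zeroʳ _)

    term : ∀ j → j ℕ.≤ q → F (j ℕ.* 2+ i) ≈ ι (B q) * (ι (q C j) * (fall x j * fall y (q ∸ j)))
    term j j≤q = begin
        ι ((q ℕ.* 2+ i) C (j ℕ.* 2+ i)) * (P (2+ i) x (j ℕ.* 2+ i) * P (2+ i) y (q ℕ.* 2+ i ∸ j ℕ.* 2+ i))
      ≈⟨ *-congˡ (*-cong (P-at-multiple i j x)
            (trans (reflexive (≡.cong (P (2+ i) y) (≡.sym (ℕ.*-distribʳ-∸ (2+ i) q j)))) (P-at-multiple i (q ∸ j) y))) ⟩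
        ι ((q ℕ.* 2+ i) C (j ℕ.* 2+ i)) * ((ι (B j) * fall x j) * (ι (B (q ∸ j)) * fall y (q ∸ j)))
      ≈⟨ solve 5 (λ c a b u v → c :* ((a :* u) :* (b :* v)) := (c :* a :* b) :* (u :* v)) refl
           (ι ((q ℕ.* 2+ i) C (j ℕ.* 2+ i))) (ι (B j)) (ι (B (q ∸ j))) (fall x j) (fall y (q ∸ j)) ⟩
        (ι ((q ℕ.* 2+ i) C (j ℕ.* 2+ i)) * ι (B j) * ι (B (q ∸ j))) * (fall x j * fall y (q ∸ j))
      ≈⟨ *-congʳ (ιblockCount-split i j q j≤q) ⟩
        (ι (B q) * ι (q C j)) * (fall x j * fall y (q ∸ j))
      ≈⟨ *-assoc _ _ _ ⟩
        ι (B q) * (ι (q C j) * (fall x j * fall y (q ∸ j))) ∎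

  P-+ : ∀ i x y → P (suc i) (x + y) ≈ₛ P (suc i) x ⋆ P (suc i) y
  P-+ zero    x y = pow-+ x y
  P-+ (suc i) x y m with 2+ i ∣? m
  ... | yes (divides q ≡.refl) = P-+-at-multiple i x y q
  ... | no i∤m = trans (P-off-multiple i m (x + y) i∤m) (sym (sumTo-zero m _ term≈0))
    where
    term≈0 : ∀ h → h ℕ.≤ m → ι (m C h) * (P (2+ i) x h * P (2+ i) y (m ∸ h)) ≈ 0#
    term≈0 h h≤m with 2+ i ∣? h
    ... | no i∤h  = trans (*-congˡ (trans (*-congʳ (P-off-multiple i h x i∤h)) (zeroˡ _))) (zeroʳ _)
    ... | yes i∣h = trans (*-congˡ (trans (*-congˡ (P-off-multiple i (m ∸ h) y
                      (λ i∣m∸h → i∤m (∣m∸n∣n⇒∣m (2+ i) h≤m i∣m∸h i∣h)))) (zeroʳ _))) (zeroʳ _)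

  ⋆P-below : ∀ i (a : Seq) y t → t ℕ.≤ i → (a ⋆ P (suc i) y) t ≈ a t
  ⋆P-below i a y t t≤i = begin
      (a ⋆ P (suc i) y) t
    ≈⟨ sumTo-last t _ (λ h h<t → trans (*-congˡ (trans (*-congˡ (P-between i y (t ∸ h) (ℕ.m<n⇒0<n∸m h<t)
                                          (s≤s (ℕ.≤-trans (ℕ.m∸n≤m t h) t≤i)))) (zeroʳ _))) (zeroʳ _)) ⟩
      ι (t C t) * (a t * P (suc i) y (t ∸ t))
    ≈⟨ *-cong (ιnCn≈1 t) (*-congˡ (trans (reflexive (≡.cong (P (suc i) y) (ℕ.n∸n≡0 t))) (P-at-0 i y))) ⟩
      1# * (a t * 1#)
    ≈⟨ trans (*-identityˡ _) (*-identityʳ _) ⟩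
      a t ∎

  ⋆P-at-i : ∀ i (a : Seq) y → a 0 ≈ 1# → (a ⋆ P (suc i) y) (suc i) ≈ a (suc i) + y
  ⋆P-at-i i a y a0≈1 = begin
      sumTo i f + f (suc i)
    ≈⟨ +-congʳ (sumTo-first i f (λ h h<i → trans (*-congˡ (trans (*-congˡ (P-between i y (i ∸ h) (ℕ.m<n⇒0<n∸m h<i)
                                                  (s≤s (ℕ.m∸n≤m i h)))) (zeroʳ _))) (zeroʳ _))) ⟩
      f 0 + f (suc i)
    ≈⟨ +-cong (trans (*-cong (ιnC0≈1 (suc i)) (*-cong a0≈1 (P-at-i i y))) (trans (*-identityˡ _) (*-identityˡ _)))
              (trans (*-cong (ιnCn≈1 (suc i)) (*-congˡ (trans (reflexive (≡.cong (P (suc i) y) (ℕ.n∸n≡0 i))) (P-at-0 i y))))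
                     (trans (*-identityˡ _) (*-identityʳ _))) ⟩
      y + a (suc i)
    ≈⟨ +-comm _ _ ⟩
      a (suc i) + y ∎
    where
    f : ℕ → Carrier
    f h = ι (suc i C h) * (a h * P (suc i) y (suc i ∸ h))

  prodP-cong : ∀ m {x y : Fin m → Carrier} → x ≋ y → prodP m x ≈ₛ prodP m y
  prodP-cong zero    x≋y = ≈ₛ-refl
  prodP-cong (suc m) x≋y = ⋆-cong (prodP-cong m (x≋y ∘ inject₁)) (P-cong m (x≋y (fromℕ m)))

  prodP-⊕ : ∀ m (x y : Fin m → Carrier) → prodP m (x ⊕ y) ≈ₛ prodP m x ⋆ prodP m y
  prodP-⊕ zero    x y = ≈ₛ-sym (⋆-identityˡ one)
  prodP-⊕ (suc m) x y = ≈ₛ-trans (⋆-cong (prodP-⊕ m (init x) (init y)) (P-+ m (last x) (last y)))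
                                 (⋆-interchange (prodP m (init x)) (prodP m (init y)) (P (suc m) (last x)) (P (suc m) (last y)))

  prodP-at-0 : ∀ m x → prodP m x 0 ≈ 1#
  prodP-at-0 zero    x = refl
  prodP-at-0 (suc m) x = trans (*-cong (ιnC0≈1 0) (*-cong (prodP-at-0 m (init x)) (P-at-0 m (last x))))
                               (trans (*-identityˡ _) (*-identityˡ _))

  ≋-init-last : ∀ {m} {x y : Fin (suc m) → Carrier} → init x ≋ init y → last x ≈ last y → x ≋ y
  ≋-init-last {m} {x} {y} init≋ last≈ j with m ℕ.≟ toℕ j
  ... | yes m≡j = ≡.subst (λ k → x k ≈ y k) (toℕ-injective (≡.trans (toℕ-fromℕ m) m≡j)) last≈
  ... | no m≢j  = ≡.subst (λ k → x k ≈ y k) (inject₁-lower₁ j m≢j) (init≋ (lower₁ j m≢j))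

  prodP-injective : ∀ m (x y : Fin m → Carrier) → (∀ t → 0 < t → t ℕ.≤ m → prodP m x t ≈ prodP m y t) → x ≋ y
  prodP-injective zero    x y _ ()
  prodP-injective (suc m) x y x≈y = ≋-init-last init≋ (+-cancelˡ (prodP m (init x) (suc m)) _ _ (begin
      prodP m (init x) (suc m) + last x   ≈⟨ ⋆P-at-i m _ _ (prodP-at-0 m (init x)) ⟨
      prodP (suc m) x (suc m)             ≈⟨ x≈y (suc m) (s≤s z≤n) ℕ.≤-refl ⟩
      prodP (suc m) y (suc m)             ≈⟨ ⋆P-at-i m _ _ (prodP-at-0 m (init y)) ⟩
      prodP m (init y) (suc m) + last y   ≈⟨ +-congʳ (prodP-cong m (sym ∘ init≋) (suc m)) ⟩
      prodP m (init x) (suc m) + last y   ∎))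
    where
    init≋ : init x ≋ init y
    init≋ = prodP-injective m (init x) (init y) (λ t 0<t t≤m →
      trans (sym (⋆P-below m _ _ t t≤m)) (trans (x≈y t 0<t (ℕ.m≤n⇒m≤1+n t≤m)) (⋆P-below m _ _ t t≤m)))

  _∷ʳ_ : ∀ {m} → (Fin m → Carrier) → Carrier → Fin (suc m) → Carrier
  _∷ʳ_ {zero}  x v zero    = v
  _∷ʳ_ {suc m} x v zero    = x zero
  _∷ʳ_ {suc m} x v (suc j) = ((x ∘ suc) ∷ʳ v) j

  init-∷ʳ : ∀ {m} (x : Fin m → Carrier) v → init (x ∷ʳ v) ≋ x
  init-∷ʳ {suc m} x v zero    = refl
  init-∷ʳ {suc m} x v (suc j) = init-∷ʳ (x ∘ suc) v j

  last-∷ʳ : ∀ {m} (x : Fin m → Carrier) v → last (x ∷ʳ v) ≈ v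
  last-∷ʳ {zero}  x v = refl
  last-∷ʳ {suc m} x v = last-∷ʳ (x ∘ suc) v

  prodP-surjective : ∀ (u : Seq) m → Σ (Fin m → Carrier) (λ x → ∀ t → 0 < t → t ℕ.≤ m → prodP m x t ≈ u t)
  prodP-surjective u zero    = (λ ()) , λ { (suc t) _ () }
  prodP-surjective u (suc m) = x ∷ʳ v , matches
    where
    x = proj₁ (prodP-surjective u m)
    v = u (suc m) - prodP m x (suc m)
    x′ = x ∷ʳ v
    prodP≈x : prodP m (init x′) ≈ₛ prodP m x
    prodP≈x = prodP-cong m (init-∷ʳ x v)
    matches : ∀ t → 0 < t → t ℕ.≤ suc m → prodP (suc m) x′ t ≈ u t
    matches t 0<t t≤1+m with ℕ.m≤n⇒m<n∨m≡n t≤1+m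
    ... | inj₁ (s≤s t≤m) = trans (⋆P-below m _ _ t t≤m) (trans (prodP≈x t) (proj₂ (prodP-surjective u m) t 0<t t≤m))
    ... | inj₂ ≡.refl    = begin
        prodP (suc m) x′ (suc m)           ≈⟨ ⋆P-at-i m _ _ (prodP-at-0 m (init x′)) ⟩
        prodP m (init x′) (suc m) + last x′ ≈⟨ +-cong (prodP≈x (suc m)) (last-∷ʳ x v) ⟩
        prodP m x (suc m) + v              ≈⟨ trans (sym (+-assoc _ _ _)) (xyx⁻¹≈y _ _) ⟩
        u (suc m)                          ∎

  ext-trunc : ∀ n (a : Seq) h → h < n → ext (trunc n a) h ≈ a h
  ext-trunc n a h h<n with h ℕ.<? n
  ... | yes h<n′ = reflexive (≡.cong a (toℕ-fromℕ< h<n′))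
  ... | no  h≮n  = contradiction h<n h≮n

  ext-toℕ : ∀ n (u : Fin n → Carrier) j → ext u (toℕ j) ≈ u j
  ext-toℕ n u j with toℕ j ℕ.<? n
  ... | yes j<n = reflexive (≡.cong u (fromℕ<-toℕ j j<n))
  ... | no  j≮n = contradiction (toℕ<n j) j≮n

  τ-InU : ∀ m x → InU (suc m) (τ (suc m) x)
  τ-InU m x j j≡0 = trans (reflexive (≡.cong (prodP m x) j≡0)) (prodP-at-0 m x)

  τ-cong : ∀ m x y → x ≋ y → τ (suc m) x ≋ τ (suc m) y
  τ-cong m x y x≋y j = prodP-cong m x≋y (toℕ j)

  τ-⊕ : ∀ m x y → τ (suc m) (x ⊕ y) ≋ (τ (suc m) x ⋆[ suc m ] τ (suc m) y)
  τ-⊕ m x y j = trans (prodP-⊕ m x y (toℕ j))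
    (⋆-cong-≤ (toℕ j) (λ h h≤j → sym (ext-trunc (suc m) (prodP m x) h (ℕ.≤-<-trans h≤j (toℕ<n j))))
                      (λ h h≤j → sym (ext-trunc (suc m) (prodP m y) h (ℕ.≤-<-trans h≤j (toℕ<n j)))))

  τ-injective : ∀ m x y → τ (suc m) x ≋ τ (suc m) y → x ≋ y
  τ-injective m x y τx≋τy = prodP-injective m x y (λ t _ t≤m →
    ≡.subst (λ t → prodP m x t ≈ prodP m y t) (toℕ-fromℕ< (s≤s t≤m)) (τx≋τy (fromℕ< (s≤s t≤m))))

  τ-surjective : ∀ m (u : Fin (suc m) → Carrier) → InU (suc m) u → Σ (Fin m → Carrier) (λ x → τ (suc m) x ≋ u)
  τ-surjective m u u∈U = x , λ j → τx≈u j (toℕ j) ≡.refl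
    where
    x = proj₁ (prodP-surjective (ext u) m)
    τx≈u : ∀ j t → toℕ j ≡ t → prodP m x (toℕ j) ≈ u j
    τx≈u j zero    j≡0 = trans (τ-InU m x j j≡0) (sym (u∈U j j≡0))
    τx≈u j (suc t) j≡1+t = trans (proj₂ (prodP-surjective (ext u) m) (toℕ j) (≡.subst (0 <_) (≡.sym j≡1+t) (s≤s z≤n))
                                                                    (ℕ.≤-pred (toℕ<n j)))
                                 (ext-toℕ (suc m) u j)

mainTheorem6 : {c ℓ : Level} (R : CommutativeRing c ℓ) (n : ℕ) → 2 ≤ n →
    let open CommutativeRing R using (Carrier)
        open Hurwitz R
    in ((x : Fin (n ∸ 1) → Carrier) → InU n (τ n x))
       × ((x y : Fin (n ∸ 1) → Carrier) → x ≋ y → τ n x ≋ τ n y)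
       × ((x y : Fin (n ∸ 1) → Carrier) → τ n (x ⊕ y) ≋ (τ n x ⋆[ n ] τ n y))
       × ((x y : Fin (n ∸ 1) → Carrier) → τ n x ≋ τ n y → x ≋ y)
       × ((u : Fin n → Carrier) → InU n u → Σ (Fin (n ∸ 1) → Carrier) (λ x → τ n x ≋ u))
-- The hypothesis n ≥ 2 is only used to exclude n = 0; the argument covers n = 1 as well.
mainTheorem6 R (suc m) (s≤s _) = τ-InU m , τ-cong m , τ-⊕ m , τ-injective m , τ-surjective m
  where open HurwitzAlgebra R
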